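{- Let $(\mathcal P,\mathcal O)$ be a semitopology and $f,f':\mathcal P\to\mathbf 3$. Then $$\mathsf{Everywhere} f\wedge\mathsf{Quorum} f'\le\mathsf{Quorum}(f\wedge f').$$ As a corollary, if $\mathsf{Everywhere}(\mathsf{TF}\circ f')\wedge\mathsf{Quorum} f'$ is valid then $\mathsf T(\mathsf{Quorum} f')$ is valid.
   Context: Truth values: $\mathbf 3=\{\mathbf f,\mathbf b,\mathbf t\}$ totally ordered by $\mathbf f<\mathbf b<\mathbf t$; $\wedge$ is min, $\bigwedge,\bigvee$ are infimum and supremum; $(f\wedge f')(p)=f(p)\wedge f'(p)$. Modalities: $\mathsf T x=\mathbf t$ if $x=\mathbf t$, else $\mathbf f$; $\mathsf{TF}x=\mathbf t$ if $x\in\{\mathbf t,\mathbf f\}$, else $\mathbf f$. A truth value is valid iff it lies in $\{\mathbf t,\mathbf b\}$. A semitopology $(\mathcal P,\mathcal O)$ is a set $\mathcal P$ with a family $\mathcal O$ of subsets containing $\mathcal P$ and closed under arbitrary (including empty) unions; $\mathcal O^{\neq\emptyset}$ is the set of nonempty members. For $f:\mathcal P\to\mathbf 3$: $\mathsf{Everywhere} f=\bigwedge_p f(p)$, $\mathsf{Quorum} f=\bigvee_{O\in\mathcal O^{\neq\emptyset}}\bigwedge_{p\in O}f(p)$. -}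

module Defs where

open import Level using (Level)
open import Data.Unit using (⊤)
open import Data.Product using (Σ; ∃; _×_; _,_)
open import Relation.Binary.PropositionalEquality using (_≡_)

data Three : Set where
  𝐟 𝐛 𝐭 : Three

data _≤₃_ : Three → Three → Set where
  f≤ : ∀ {x} → 𝐟 ≤₃ x
  b≤b : 𝐛 ≤₃ 𝐛
  b≤t : 𝐛 ≤₃ 𝐭
  t≤t : 𝐭 ≤₃ 𝐭

infix 4 _≤₃_

_∧₃_ : Three → Three → Three
𝐟 ∧₃ y = 𝐟
𝐛 ∧₃ 𝐟 = 𝐟
𝐛 ∧₃ 𝐛 = 𝐛
𝐛 ∧₃ 𝐭 = 𝐛
𝐭 ∧₃ y = y

infixr 6 _∧₃_

_∧ᶠ_ : {P : Set} → (P → Three) → (P → Three) → P → Three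
(f ∧ᶠ g) p = f p ∧₃ g p

T : Three → Three
T 𝐭 = 𝐭
T _ = 𝐟

TF : Three → Three
TF 𝐭 = 𝐭
TF 𝐛 = 𝐟
TF 𝐟 = 𝐭

Valid : Three → Set
Valid x = 𝐛 ≤₃ x

-- Infimum / supremum of a (possibly infinite) set of truth values,
-- given as a predicate; stated relationally since they are not
-- computable constructively.
IsInf : {ℓ : Level} → (Three → Set ℓ) → Three → Set ℓ
IsInf S x = (∀ y → S y → x ≤₃ y) × (∀ z → (∀ y → S y → z ≤₃ y) → z ≤₃ x)

IsSup : {ℓ : Level} → (Three → Set ℓ) → Three → Set ℓ
IsSup S x = (∀ y → S y → y ≤₃ x) × (∀ z → (∀ y → S y → y ≤₃ z) → x ≤₃ z)

record Semitopology (P : Set) : Set₁ where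
  field
    Open   : (P → Set) → Set
    full   : Open (λ _ → ⊤)
    unions : {I : Set} (U : I → P → Set) → (∀ i → Open (U i)) →
             Open (λ p → ∃ λ i → U i p)

Image : {P : Set} → (P → Set) → (P → Three) → Three → Set
Image {P} O f v = Σ P λ p → O p × (v ≡ f p)

EverywhereIs : {P : Set} → (P → Three) → Three → Set
EverywhereIs f e = IsInf (Image (λ _ → ⊤) f) e

-- q is Quorum f = ⋁_{O ∈ O≠∅} ⋀_{p ∈ O} f p
QuorumIs : {P : Set} → Semitopology P → (P → Three) → Three → Set₁
QuorumIs {P} S f q =
  IsSup (λ v → Σ (P → Set) λ O →
                 Semitopology.Open S O × (Σ P O) × IsInf (Image O f) v) q

-- Over the chain 𝐟 < 𝐛 < 𝐭 a meet x ∧ y lies below r iff x or y does, so x ∧ ⋁ yᵢ ≤ r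
-- reduces to x ∧ yᵢ ≤ r for each i; and for each nonempty open O the value
-- Everywhere f ∧ ⋀_O f' is a lower bound of f ∧ f' on O, hence below Quorum (f ∧ f').
-- For the corollary, a valid Everywhere (TF ∘ f') forces f' to avoid 𝐛; infima and
-- suprema of values avoiding 𝐛 avoid 𝐛, so a valid Quorum f' must be 𝐭.
module Submission where

open import Defs
open import Data.Empty using (⊥-elim)
open import Data.Product using (Σ; _×_; _,_; proj₁; proj₂)
open import Data.Sum using (_⊎_; inj₁; inj₂)
open import Data.Unit using (tt)
open import Function using (_∘_)
open import Relation.Binary.PropositionalEquality using (_≢_; refl)
open import Relation.Nullary using (¬_; Dec; yes; no)
open import Relation.Nullary.Decidable using (decidable-stable; ¬¬-excluded-middle)

≤₃-refl : ∀ {x} → x ≤₃ x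
≤₃-refl {𝐟} = f≤
≤₃-refl {𝐛} = b≤b
≤₃-refl {𝐭} = t≤t

≤₃-trans : ∀ {x y z} → x ≤₃ y → y ≤₃ z → x ≤₃ z
≤₃-trans f≤  _   = f≤
≤₃-trans b≤b y≤z = y≤z
≤₃-trans b≤t t≤t = b≤t
≤₃-trans t≤t t≤t = t≤t

x≤₃𝐭 : ∀ {x} → x ≤₃ 𝐭
x≤₃𝐭 {𝐟} = f≤
x≤₃𝐭 {𝐛} = b≤t
x≤₃𝐭 {𝐭} = t≤t

_≤₃?_ : ∀ x y → Dec (x ≤₃ y)
𝐟 ≤₃? _ = yes f≤
𝐛 ≤₃? 𝐟 = no λ ()
𝐛 ≤₃? 𝐛 = yes b≤b
𝐛 ≤₃? 𝐭 = yes b≤t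
𝐭 ≤₃? 𝐟 = no λ ()
𝐭 ≤₃? 𝐛 = no λ ()
𝐭 ≤₃? 𝐭 = yes t≤t

∧₃-lowerˡ : ∀ x y → x ∧₃ y ≤₃ x
∧₃-lowerˡ 𝐟 _ = f≤
∧₃-lowerˡ 𝐛 𝐟 = f≤
∧₃-lowerˡ 𝐛 𝐛 = b≤b
∧₃-lowerˡ 𝐛 𝐭 = b≤b
∧₃-lowerˡ 𝐭 _ = x≤₃𝐭

∧₃-lowerʳ : ∀ x y → x ∧₃ y ≤₃ y
∧₃-lowerʳ 𝐟 _ = f≤
∧₃-lowerʳ 𝐛 𝐟 = f≤
∧₃-lowerʳ 𝐛 𝐛 = b≤b
∧₃-lowerʳ 𝐛 𝐭 = b≤t
∧₃-lowerʳ 𝐭 _ = ≤₃-refl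

∧₃-mono : ∀ {x y u v} → x ≤₃ u → y ≤₃ v → x ∧₃ y ≤₃ u ∧₃ v
∧₃-mono f≤  _   = f≤
∧₃-mono b≤b f≤  = f≤
∧₃-mono b≤b b≤b = b≤b
∧₃-mono b≤b b≤t = b≤b
∧₃-mono b≤b t≤t = b≤b
∧₃-mono b≤t f≤  = f≤
∧₃-mono b≤t b≤b = b≤b
∧₃-mono b≤t b≤t = b≤t
∧₃-mono b≤t t≤t = b≤t
∧₃-mono t≤t y≤v = y≤v

∧₃-≤-split : ∀ x y {z} → x ∧₃ y ≤₃ z → x ≤₃ z ⊎ y ≤₃ z
∧₃-≤-split 𝐟 _ _   = inj₁ f≤
∧₃-≤-split 𝐛 𝐟 _   = inj₂ f≤
∧₃-≤-split 𝐛 𝐛 b≤z = inj₁ b≤z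
∧₃-≤-split 𝐛 𝐭 b≤z = inj₁ b≤z
∧₃-≤-split 𝐭 _ y≤z = inj₂ y≤z

∧₃-distrib-sup-≤ : ∀ {ℓ} {S : Three → Set ℓ} {q} x {r} → IsSup S q →
                   (∀ y → S y → x ∧₃ y ≤₃ r) → x ∧₃ q ≤₃ r
∧₃-distrib-sup-≤ x {r} q-sup x∧S≤r with x ≤₃? r
... | yes x≤r = ≤₃-trans (∧₃-lowerˡ x _) x≤r
... | no  x≰r = ≤₃-trans (∧₃-lowerʳ x _) (proj₂ q-sup r S≤r)
  where
  S≤r : ∀ y → _ → y ≤₃ r
  S≤r y Sy with ∧₃-≤-split x y (x∧S≤r y Sy)
  ... | inj₁ x≤r = ⊥-elim (x≰r x≤r)
  ... | inj₂ y≤r = y≤r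

LowerBound : (Three → Set) → Three → Set
LowerBound S z = ∀ y → S y → z ≤₃ y

-- Infima in 𝟑 exist only up to double negation, which suffices for the decidable ≤₃.
¬¬-inf : (S : Three → Set) → ¬ ¬ Σ Three (IsInf S)
¬¬-inf S k = ¬¬-excluded-middle λ where
  (yes 𝐭-lb) → k (𝐭 , 𝐭-lb , λ _ _ → x≤₃𝐭)
  (no 𝐭-not-lb) → ¬¬-excluded-middle λ where
    (yes 𝐛-lb) → k (𝐛 , 𝐛-lb , λ where
      𝐟 _ → f≤
      𝐛 _ → b≤b
      𝐭 𝐭-lb → ⊥-elim (𝐭-not-lb 𝐭-lb))
    (no 𝐛-not-lb) → k (𝐟 , (λ _ _ → f≤) , λ where
      𝐟 _ → f≤
      𝐛 𝐛-lb → ⊥-elim (𝐛-not-lb 𝐛-lb)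
      𝐭 𝐭-lb → ⊥-elim (𝐭-not-lb 𝐭-lb))

module _ {P : Set} (S : Semitopology P) where
  open Semitopology S

  lowerBound-≤-Quorum : ∀ {g r z} (O : P → Set) → Open O → Σ P O →
                        LowerBound (Image O g) z → QuorumIs S g r → z ≤₃ r
  lowerBound-≤-Quorum {g} {r} {z} O O-open O-inhabited z-lb r-sup =
    decidable-stable (z ≤₃? r) λ z≰r → ¬¬-inf (Image O g) λ where
      (x , x-inf) → z≰r (≤₃-trans (proj₂ x-inf z z-lb)
                                  (proj₁ r-sup x (O , O-open , O-inhabited , x-inf)))

  Everywhere∧Quorum≤Quorum∧ : ∀ (f f' : P → Three) {e q r} → EverywhereIs f e →
                              QuorumIs S f' q → QuorumIs S (f ∧ᶠ f') r → e ∧₃ q ≤₃ r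
  Everywhere∧Quorum≤Quorum∧ f f' {e} e-inf q-sup r-sup =
    ∧₃-distrib-sup-≤ e q-sup λ where
      y (O , O-open , O-inhabited , y-inf) →
        lowerBound-≤-Quorum O O-open O-inhabited (e∧y-lb O y-inf) r-sup
    where
    e∧y-lb : ∀ O {y} → IsInf (Image O f') y → LowerBound (Image O (f ∧ᶠ f')) (e ∧₃ y)
    e∧y-lb O y-inf _ (p , Op , refl) =
      ∧₃-mono (proj₁ e-inf (f p) (p , tt , refl)) (proj₁ y-inf (f' p) (p , Op , refl))

Classical : Three → Set
Classical x = x ≢ 𝐛

valid-TF⇒classical : ∀ {x} → Valid (TF x) → Classical x
valid-TF⇒classical () refl

classical-valid⇒𝐭 : ∀ {x} → Classical x → Valid x → 𝐭 ≤₃ x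
classical-valid⇒𝐭 {𝐛} ¬𝐛 _ = ⊥-elim (¬𝐛 refl)
classical-valid⇒𝐭 {𝐭} _   _ = t≤t

classical-valid⇒valid-T : ∀ {x} → Classical x → Valid x → Valid (T x)
classical-valid⇒valid-T x-classical x-valid with classical-valid⇒𝐭 x-classical x-valid
... | t≤t = b≤t

classical-≤𝐛⇒𝐟 : ∀ {x} → Classical x → x ≤₃ 𝐛 → x ≤₃ 𝐟
classical-≤𝐛⇒𝐟 {𝐟} _   _ = f≤
classical-≤𝐛⇒𝐟 {𝐛} ¬𝐛 _ = ⊥-elim (¬𝐛 refl)

inf-classical : ∀ {S : Three → Set} {x} → (∀ y → S y → Classical y) → IsInf S x → Classical x
inf-classical S-classical (𝐛-lb , greatest) refl
  with greatest 𝐭 (λ y Sy → classical-valid⇒𝐭 (S-classical y Sy) (𝐛-lb y Sy))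
... | ()

sup-classical : ∀ {ℓ} {S : Three → Set ℓ} {x} → (∀ y → S y → Classical y) → IsSup S x →
                Classical x
sup-classical S-classical (𝐛-ub , least) refl
  with least 𝐟 (λ y Sy → classical-≤𝐛⇒𝐟 (S-classical y Sy) (𝐛-ub y Sy))
... | ()

valid-∧₃ : ∀ x y → Valid (x ∧₃ y) → Valid x × Valid y
valid-∧₃ x y v = ≤₃-trans v (∧₃-lowerˡ x y) , ≤₃-trans v (∧₃-lowerʳ x y)

quorum-classical : ∀ {P : Set} (S : Semitopology P) {f' : P → Three} {q} →
                   (∀ p → Classical (f' p)) → QuorumIs S f' q → Classical q
quorum-classical _ f'-classical = sup-classical λ where
  _ (_ , _ , _ , y-inf) → inf-classical (λ { _ (p , _ , refl) → f'-classical p }) y-inf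

lemma2p10 : {P : Set} (S : Semitopology P) (f f' : P → Three) →
    (∀ e q r → EverywhereIs f e → QuorumIs S f' q → QuorumIs S (f ∧ᶠ f') r →
       e ∧₃ q ≤₃ r)
    × (∀ e q → EverywhereIs (TF ∘ f') e → QuorumIs S f' q → Valid (e ∧₃ q) →
       Valid (T q))
lemma2p10 S f f' =
    (λ _ _ _ → Everywhere∧Quorum≤Quorum∧ S f f')
  , λ e q e-inf q-sup e∧q-valid →
      let (e-valid , q-valid) = valid-∧₃ e q e∧q-valid
          f'-classical p = valid-TF⇒classical (≤₃-trans e-valid (proj₁ e-inf _ (p , tt , refl)))
      in classical-valid⇒valid-T (quorum-classical S f'-classical q-sup) q-valid
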